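{- Let $k\geq 2$ be an integer, $H$ a finite connected simple graph, $r$ a non-negative integer, and $u$ a vertex of $H$ incident with exactly $r$ pendant edges $uw_1,\dots,uw_r$ (each $w_i$ a leaf). Let $G$ be the graph obtained from $H$ by subdividing each pendant edge $uw_i$ by a new vertex $v_i$. (1) If $k$ is even and every $\gamma_k(G)$-function $f$ satisfies $f(u)<k/2$, then $r=0$. (2) If $k$ is odd and every $\gamma_k^s(G)$-function $f$ satisfies $f(u)<k/2$, then $r\leq 1$.
   Context: For $f:V(G)\to\{0,1,\dots,k\}$ let $w(f)=\sum_v f(v)$. $f$ is a Roman $k$-dominating function ($k$-RDF) if every $x$ with $f(x)<k/2$ satisfies $\sum_{y\in N_G[x]}f(y)\geq k$ (closed neighbourhood); it is a strong Roman $k$-dominating function ($k$-SRDF) if every $x$ with $f(x)<k/2$ satisfies $f(x)+\sum_{y\in N_G(x),\, f(y)>k/2}f(y)\geq k$ (open neighbourhood). $\gamma_k(G)$ (resp. $\gamma_k^s(G)$) is the minimum weight of a $k$-RDF (resp. $k$-SRDF); a $\gamma_k(G)$-function (resp. $\gamma_k^s(G)$-function) is a $k$-RDF (resp. $k$-SRDF) of that minimum weight. -}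

module Defs where

open import Data.Nat using (ℕ; zero; suc; _+_; _*_; _≤_; _<_; _<?_)
open import Data.Bool using (Bool; true; false; if_then_else_; _∧_; _∨_; not)
open import Data.Fin using (Fin; zero; suc; splitAt; _↑ˡ_; _≟_)
open import Data.Sum using (_⊎_; inj₁; inj₂)
open import Data.Product using (_×_; ∃)
open import Relation.Nullary.Decidable using (⌊_⌋)
open import Relation.Binary.PropositionalEquality using (_≡_)
open import Function.Definitions using (Injective)

sumFin : (m : ℕ) → (Fin m → ℕ) → ℕ
sumFin zero    g = 0
sumFin (suc m) g = g zero + sumFin m (λ i → g (suc i))

anyFin : (m : ℕ) → (Fin m → Bool) → Bool
anyFin zero    p = false
anyFin (suc m) p = p zero ∨ anyFin m (λ i → p (suc i))

record SimpleGraph (n : ℕ) : Set where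
  field
    adj    : Fin n → Fin n → Bool
    sym    : ∀ a b → adj a b ≡ adj b a
    irrefl : ∀ a → adj a a ≡ false
open SimpleGraph public

data Reach {n : ℕ} (G : SimpleGraph n) : Fin n → Fin n → Set where
  here : ∀ {a} → Reach G a a
  step : ∀ {a b c} → adj G a b ≡ true → Reach G b c → Reach G a c

Connected : {n : ℕ} → SimpleGraph n → Set
Connected {n} G = ∀ (a b : Fin n) → Reach G a b

degree : {n : ℕ} → SimpleGraph n → Fin n → ℕ
degree {n} G a = sumFin n (λ y → if adj G a y then 1 else 0)

IsLeaf : {n : ℕ} → SimpleGraph n → Fin n → Set
IsLeaf G a = degree G a ≡ 1

-- w : Fin r → Fin n enumerates (without repetition) exactly the leaves adjacent
-- to u, i.e. the pendant edges u w₁, …, u wᵣ at u.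
PendantAt : {n : ℕ} → SimpleGraph n → Fin n → (r : ℕ) → (Fin r → Fin n) → Set
PendantAt {n} H u r w =
  Injective _≡_ _≡_ w
  × (∀ i → adj H u (w i) ≡ true)
  × (∀ i → IsLeaf H (w i))
  × (∀ a → adj H u a ≡ true → IsLeaf H a → ∃ λ i → w i ≡ a)

-- Adjacency of G: vertices Fin (n + r); the first n are those of H, the
-- vertex (n + i) is the subdivision vertex vᵢ of the edge u wᵢ.
subdivAdj : {n : ℕ} → SimpleGraph n → Fin n → (r : ℕ) → (Fin r → Fin n)
          → Fin (n + r) → Fin (n + r) → Bool
subdivAdj {n} H u r w x y = go (splitAt n x) (splitAt n y)
  where
  inW : Fin n → Bool
  inW b = anyFin r (λ i → ⌊ w i ≟ b ⌋)
  removed : Fin n → Fin n → Bool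
  removed a b = (⌊ a ≟ u ⌋ ∧ inW b) ∨ (⌊ b ≟ u ⌋ ∧ inW a)
  go : Fin n ⊎ Fin r → Fin n ⊎ Fin r → Bool
  go (inj₁ a) (inj₁ b) = adj H a b ∧ not (removed a b)
  go (inj₁ a) (inj₂ i) = ⌊ a ≟ u ⌋ ∨ ⌊ a ≟ w i ⌋
  go (inj₂ i) (inj₁ a) = ⌊ a ≟ u ⌋ ∨ ⌊ a ≟ w i ⌋
  go (inj₂ i) (inj₂ j) = false

weight : (m : ℕ) → (Fin m → ℕ) → ℕ
weight m f = sumFin m f

closedNbSum : (m : ℕ) → (Fin m → Fin m → Bool) → (Fin m → ℕ) → Fin m → ℕ
closedNbSum m adj f x = sumFin m (λ y → if ⌊ x ≟ y ⌋ ∨ adj x y then f y else 0)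

strongNbSum : (m : ℕ) → (Fin m → Fin m → Bool) → ℕ → (Fin m → ℕ) → Fin m → ℕ
strongNbSum m adj k f x =
  sumFin m (λ y → if adj x y ∧ ⌊ k <? 2 * f y ⌋ then f y else 0)

-- f : V → {0,…,k}; condition f(x) < k/2 written as 2 f(x) < k.
IsRDF : (m : ℕ) → (Fin m → Fin m → Bool) → ℕ → (Fin m → ℕ) → Set
IsRDF m adj k f = (∀ x → f x ≤ k) × (∀ x → 2 * f x < k → k ≤ closedNbSum m adj f x)

IsSRDF : (m : ℕ) → (Fin m → Fin m → Bool) → ℕ → (Fin m → ℕ) → Set
IsSRDF m adj k f = (∀ x → f x ≤ k) × (∀ x → 2 * f x < k → k ≤ f x + strongNbSum m adj k f x)

IsGammaRDF : (m : ℕ) → (Fin m → Fin m → Bool) → ℕ → (Fin m → ℕ) → Set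
IsGammaRDF m adj k f = IsRDF m adj k f × (∀ g → IsRDF m adj k g → weight m f ≤ weight m g)

IsGammaSRDF : (m : ℕ) → (Fin m → Fin m → Bool) → ℕ → (Fin m → ℕ) → Set
IsGammaSRDF m adj k f = IsSRDF m adj k f × (∀ g → IsSRDF m adj k g → weight m f ≤ weight m g)

module Submission where

-- Let g be a Roman k-dominating function of G and u vᵢ wᵢ a subdivided pendant path. Raise
-- g(u) to at least h = ⌈k/2⌉ and move the weight of the path onto its leaf: g(vᵢ) = 0,
-- g(wᵢ) = h. The result is again dominating: u and wᵢ are no longer light, vᵢ sees u and wᵢ,
-- and every other vertex keeps its value and sees neither vᵢ nor wᵢ. It is no heavier: the
-- domination conditions at wᵢ and vᵢ give g(vᵢ) + g(wᵢ) ≥ k/2, and ≥ k − g(u) (even k)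
-- resp. ≥ k (odd k, strong version, u light). For k = 2t one path pays for raising u; for
-- k = 2t + 1 two paths are needed, using 3(t + 1) ≤ 2k. Applied to a minimum-weight function
-- this gives a γ-function heavy at u. Since minimality quantifies over all functions, such a
-- minimum exists only under a double negation, which suffices for a proof by contradiction.

open import Data.Bool using (Bool; true; false; if_then_else_; _∧_; _∨_; not)
open import Data.Bool.Properties using (∨-zeroʳ; ∨-comm)
open import Data.Fin using (Fin; zero; suc; _≟_; splitAt; _↑ˡ_; _↑ʳ_)
open import Data.Fin.Properties
  using (splitAt-↑ˡ; splitAt-↑ʳ; splitAt⁻¹-↑ˡ; splitAt⁻¹-↑ʳ; ↑ˡ-injective; ↑ʳ-injective)
open import Data.List using ([]; _∷_; map)
open import Data.List.Membership.Propositional using (_∈_; _∉_)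
open import Data.List.Properties using (map-cong-local)
open import Data.List.Relation.Unary.All as All using (All; []; _∷_)
open import Data.List.Relation.Unary.Any using (here; there)
open import Data.List.Relation.Unary.Unique.Propositional using (Unique; []; _∷_)
open import Data.Nat using (ℕ; zero; suc; _+_; _*_; _%_; _/_; _≤_; _<_; _⊔_; z≤n; s≤s; s≤s⁻¹; _<?_; _≤?_)
open import Data.Nat.DivMod using (m≡m%n+[m/n]*n)
open import Data.Nat.ListAction using (sum)
open import Data.Nat.Properties hiding (_≟_)
open import Algebra.Properties.CommutativeSemigroup +-commutativeSemigroup using (xy∙z≈zy∙x; x∙yz≈y∙xz)
open import Data.Nat.Tactic.RingSolver using (solve-∀)
open import Data.Product using (_×_; _,_; ∃; proj₁; proj₂; uncurry)
open import Data.Sum as Sum using (_⊎_; inj₁; inj₂; [_,_]; [_,_]′)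
open import Data.Vec.Functional using (updateAt)
open import Data.Vec.Functional.Properties using (updateAt-updates; updateAt-minimal)
open import Defs hiding (sym)
open import Function using (_∘_; const)
open import Relation.Binary.PropositionalEquality hiding ([_])
open import Relation.Nullary using (¬_; yes; no; contradiction)
open import Relation.Nullary.Decidable using (⌊_⌋; isYes≗does; dec-true)

sumFin-mono : ∀ m {f g : Fin m → ℕ} → (∀ y → f y ≤ g y) → sumFin m f ≤ sumFin m g
sumFin-mono zero    f≤g = z≤n
sumFin-mono (suc m) f≤g = +-mono-≤ (f≤g zero) (sumFin-mono m (f≤g ∘ suc))

sumFin-zero : ∀ m {f : Fin m → ℕ} → (∀ y → f y ≡ 0) → sumFin m f ≡ 0
sumFin-zero zero    f≡0 = refl
sumFin-zero (suc m) f≡0 = cong₂ _+_ (f≡0 zero) (sumFin-zero m (f≡0 ∘ suc))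

sumFin-updateAt : ∀ m (f : Fin m → ℕ) i (φ : ℕ → ℕ) →
                  sumFin m (updateAt f i φ) + f i ≡ sumFin m f + φ (f i)
sumFin-updateAt (suc m) f zero    φ = xy∙z≈zy∙x (φ (f zero)) _ (f zero)
sumFin-updateAt (suc m) f (suc i) φ = begin
  f zero + sumFin m (updateAt (f ∘ suc) i φ) + f (suc i)
    ≡⟨ +-assoc (f zero) _ _ ⟩
  f zero + (sumFin m (updateAt (f ∘ suc) i φ) + f (suc i))
    ≡⟨ cong (f zero +_) (sumFin-updateAt m (f ∘ suc) i φ) ⟩
  f zero + (sumFin m (f ∘ suc) + φ (f (suc i)))
    ≡⟨ +-assoc (f zero) _ _ ⟨
  f zero + sumFin m (f ∘ suc) + φ (f (suc i))
    ∎
  where open ≡-Reasoning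

sum-map-mono : ∀ {A : Set} {f g : A → ℕ} → (∀ x → f x ≤ g x) → ∀ xs → sum (map f xs) ≤ sum (map g xs)
sum-map-mono f≤g []       = z≤n
sum-map-mono f≤g (x ∷ xs) = +-mono-≤ (f≤g x) (sum-map-mono f≤g xs)

sum-map-≤-sumFin : ∀ m (f : Fin m → ℕ) {ps} → Unique ps → sum (map f ps) ≤ sumFin m f
sum-map-≤-sumFin m f {[]}     []            = z≤n
sum-map-≤-sumFin m f {p ∷ ps} (p∉ps ∷ uniq) = begin
  f p + sum (map f ps)  ≡⟨ cong (λ qs → f p + sum qs) (map-cong-local (All.map agree p∉ps)) ⟩
  f p + sum (map f₀ ps) ≤⟨ +-monoʳ-≤ (f p) (sum-map-≤-sumFin m f₀ uniq) ⟩
  f p + sumFin m f₀     ≡⟨ +-comm (f p) _ ⟩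
  sumFin m f₀ + f p     ≡⟨ sumFin-updateAt m f p (const 0) ⟩
  sumFin m f + 0        ≡⟨ +-identityʳ _ ⟩
  sumFin m f            ∎
  where
  open ≤-Reasoning
  f₀ : Fin m → ℕ
  f₀ = updateAt f p (const 0)
  agree : ∀ {q} → p ≢ q → f q ≡ f₀ q
  agree p≢q = sym (updateAt-minimal _ p f (p≢q ∘ sym))

sumFin-≤-sum-map : ∀ m (f : Fin m → ℕ) {ps} → (∀ y → y ∉ ps → f y ≡ 0) → sumFin m f ≤ sum (map f ps)
sumFin-≤-sum-map m f {[]}     outside = ≤-reflexive (sumFin-zero m (λ y → outside y λ ()))
sumFin-≤-sum-map m f {p ∷ ps} outside = begin
  sumFin m f            ≡⟨ +-identityʳ _ ⟨
  sumFin m f + 0        ≡⟨ sumFin-updateAt m f p (const 0) ⟨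
  sumFin m f₀ + f p     ≤⟨ +-monoˡ-≤ (f p) (sumFin-≤-sum-map m f₀ outside₀) ⟩
  sum (map f₀ ps) + f p ≤⟨ +-monoˡ-≤ (f p) (sum-map-mono f₀≤f ps) ⟩
  sum (map f ps) + f p  ≡⟨ +-comm _ (f p) ⟩
  f p + sum (map f ps)  ∎
  where
  open ≤-Reasoning
  f₀ : Fin m → ℕ
  f₀ = updateAt f p (const 0)
  f₀≤f : ∀ y → f₀ y ≤ f y
  f₀≤f y with y ≟ p
  ... | yes refl = subst (_≤ f p) (sym (updateAt-updates p f)) z≤n
  ... | no y≢p   = ≤-reflexive (updateAt-minimal y p f y≢p)
  outside₀ : ∀ y → y ∉ ps → f₀ y ≡ 0
  outside₀ y y∉ps with y ≟ p
  ... | yes refl = updateAt-updates p f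
  ... | no y≢p   = trans (updateAt-minimal y p f y≢p)
                         (outside y λ { (here y≡p) → y≢p y≡p ; (there y∈ps) → y∉ps y∈ps })

sumFin-masked-≤ : ∀ m (b : Fin m → Bool) (f : Fin m → ℕ) {ps} → (∀ y → b y ≡ true → y ∈ ps) →
                  sumFin m (λ y → if b y then f y else 0) ≤ sum (map f ps)
sumFin-masked-≤ m b f {ps} b⊆ps = ≤-trans (sumFin-≤-sum-map m masked outside) (sum-map-mono masked≤f ps)
  where
  masked : Fin m → ℕ
  masked y = if b y then f y else 0
  outside : ∀ y → y ∉ ps → masked y ≡ 0
  outside y y∉ps with b y in eq
  ... | true  = contradiction (b⊆ps y eq) y∉ps
  ... | false = refl
  masked≤f : ∀ y → masked y ≤ f y
  masked≤f y with b y
  ... | true  = ≤-refl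
  ... | false = z≤n

sumFin-masked-≥ : ∀ m (b : Fin m → Bool) (f : Fin m → ℕ) {ps} → Unique ps → All (λ p → b p ≡ true) ps →
                  sum (map f ps) ≤ sumFin m (λ y → if b y then f y else 0)
sumFin-masked-≥ m b f uniq bps =
  subst (_≤ _) (cong sum (map-cong-local (All.map (λ {p} e → cong (λ c → if c then f p else 0) e) bps)))
        (sum-map-≤-sumFin m (λ y → if b y then f y else 0) uniq)

¬¬-minimal-satisfying : ∀ {a p q} {A : Set a} (μ : A → ℕ) {P : A → Set p} {Q : A → Set q} →
                        ∃ P → (∀ g → P g → ∃ λ f → P f × μ f ≤ μ g × Q f) →
                        ¬ ¬ ∃ λ f → (P f × ∀ h → P h → μ f ≤ μ h) × Q f
¬¬-minimal-satisfying μ {P} (g₀ , Pg₀) improve none = below (suc (μ g₀)) g₀ ≤-refl Pg₀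
  where
  below : ∀ n g → μ g < n → ¬ P g
  below zero    g ()
  below (suc n) g μg<1+n Pg with improve g Pg
  ... | f , Pf , μf≤μg , Qf = none (f , (Pf , minimal) , Qf)
    where
    minimal : ∀ h → P h → μ f ≤ μ h
    minimal h Ph = ≮⇒≥ λ μh<μf → below n h (<-≤-trans μh<μf (≤-trans μf≤μg (s≤s⁻¹ μg<1+n))) Ph

-- Weight bookkeeping free of truncated subtraction: x + a ≡ y + b says x = y + b − a.
balance-trans : ∀ x y z {a b c d} → x + a ≡ y + b → y + c ≡ z + d → x + (c + a) ≡ z + (d + b)
balance-trans x y z {a} {b} {c} {d} xa≡yb yc≡zd = begin
  x + (c + a) ≡⟨ x∙yz≈y∙xz x c a ⟩
  c + (x + a) ≡⟨ cong (c +_) xa≡yb ⟩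
  c + (y + b) ≡⟨ +-assoc c y b ⟨
  c + y + b   ≡⟨ cong (_+ b) (trans (+-comm c y) yc≡zd) ⟩
  z + d + b   ≡⟨ +-assoc z d b ⟩
  z + (d + b) ∎
  where open ≡-Reasoning

balance⇒≤ : ∀ {x y a b} → x + a ≡ y + b → b ≤ a → x ≤ y
balance⇒≤ {x} {y} {a} xa≡yb b≤a = +-cancelʳ-≤ a x y (≤-trans (≤-reflexive xa≡yb) (+-monoʳ-≤ y b≤a))

k≤2a⇒k≤2b⇒k≤a+b : ∀ {k a b} → k ≤ 2 * a → k ≤ 2 * b → k ≤ a + b
k≤2a⇒k≤2b⇒k≤a+b {k} {a} {b} k≤2a k≤2b = *-cancelˡ-≤ 2 (begin
  2 * k         ≡⟨ cong (k +_) (+-identityʳ k) ⟩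
  k + k         ≤⟨ +-mono-≤ k≤2a k≤2b ⟩
  2 * a + 2 * b ≡⟨ *-distribˡ-+ 2 a b ⟨
  2 * (a + b)   ∎)
  where open ≤-Reasoning

-- a, b, c stand for the values at vᵢ, wᵢ, u; the hypotheses are the domination conditions
-- at wᵢ and at vᵢ.
pendantPath-≥ : ∀ k a b → (2 * b < k → k ≤ b + a) → k ≤ 2 * (a + b)
pendantPath-≥ k a b leafDom with 2 * b <? k
... | yes 2b<k = ≤-trans (leafDom 2b<k) (≤-trans (≤-reflexive (+-comm b a)) (m≤n*m (a + b) 2))
... | no 2b≮k  = ≤-trans (≮⇒≥ 2b≮k) (*-monoʳ-≤ 2 (m≤n+m b a))

pendantPath-centre-≥ : ∀ k a b c → (2 * b < k → k ≤ b + a) → (2 * a < k → k ≤ a + (c + b)) →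
                       k ≤ c + (a + b)
pendantPath-centre-≥ k a b c leafDom middleDom with 2 * b <? k | 2 * a <? k
... | yes 2b<k | _        = ≤-trans (leafDom 2b<k) (≤-trans (≤-reflexive (+-comm b a)) (m≤n+m (a + b) c))
... | no _     | yes 2a<k = ≤-trans (middleDom 2a<k) (≤-reflexive (x∙yz≈y∙xz a c b))
... | no 2b≮k  | no 2a≮k  =
  ≤-trans (k≤2a⇒k≤2b⇒k≤a+b {k} {a} {b} (≮⇒≥ 2a≮k) (≮⇒≥ 2b≮k)) (m≤n+m (a + b) c)

even-budget : ∀ t a P → 2 * t ≤ 2 * P → 2 * t ≤ a + P → (a ⊔ t) + t ≤ a + P
even-budget t a P 2t≤2P 2t≤a+P with t ≤? a
... | yes t≤a = begin
  (a ⊔ t) + t ≡⟨ cong (_+ t) (m≥n⇒m⊔n≡m t≤a) ⟩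
  a + t       ≤⟨ +-monoʳ-≤ a (*-cancelˡ-≤ 2 2t≤2P) ⟩
  a + P       ∎
  where open ≤-Reasoning
... | no t≰a = begin
  (a ⊔ t) + t ≡⟨ cong (_+ t) (m≤n⇒m⊔n≡n (<⇒≤ (≰⇒> t≰a))) ⟩
  t + t       ≡⟨ cong (t +_) (+-identityʳ t) ⟨
  2 * t       ≤⟨ 2t≤a+P ⟩
  a + P       ∎
  where open ≤-Reasoning

3[1+t]≤2[1+2t] : ∀ t → 1 ≤ t → suc t + (suc t + suc t) ≤ suc (2 * t) + suc (2 * t)
3[1+t]≤2[1+2t] (suc t) _ = ≤-trans (m≤m+n _ t) (≤-reflexive (identity t))
  where
  identity : ∀ t → suc (suc t) + (suc (suc t) + suc (suc t)) + t ≡ suc (2 * suc t) + suc (2 * suc t)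
  identity = solve-∀

odd-budget : ∀ t a Pᵢ Pⱼ → 1 ≤ t → suc (2 * t) ≤ 2 * Pᵢ → suc (2 * t) ≤ 2 * Pⱼ →
             (¬ suc (2 * t) < 2 * a → suc (2 * t) ≤ Pᵢ × suc (2 * t) ≤ Pⱼ) →
             (a ⊔ suc t) + (suc t + suc t) ≤ a + (Pᵢ + Pⱼ)
odd-budget t a Pᵢ Pⱼ 1≤t k≤2Pᵢ k≤2Pⱼ light with suc (2 * t) <? 2 * a
... | yes k<2a = begin
  (a ⊔ suc t) + (suc t + suc t) ≡⟨ cong (_+ (suc t + suc t)) (m≥n⇒m⊔n≡m (half a (<⇒≤ k<2a))) ⟩
  a + (suc t + suc t)           ≤⟨ +-monoʳ-≤ a (+-mono-≤ (half Pᵢ k≤2Pᵢ) (half Pⱼ k≤2Pⱼ)) ⟩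
  a + (Pᵢ + Pⱼ)                 ∎
  where
  open ≤-Reasoning
  half : ∀ P → suc (2 * t) ≤ 2 * P → suc t ≤ P
  half = *-cancelˡ-< 2 t
... | no k≮2a = begin
  (a ⊔ suc t) + (suc t + suc t) ≡⟨ cong (_+ (suc t + suc t)) (m≤n⇒m⊔n≡n (m≤n⇒m≤1+n a≤t)) ⟩
  suc t + (suc t + suc t)       ≤⟨ 3[1+t]≤2[1+2t] t 1≤t ⟩
  suc (2 * t) + suc (2 * t)     ≤⟨ +-mono-≤ (proj₁ (light k≮2a)) (proj₂ (light k≮2a)) ⟩
  Pᵢ + Pⱼ                       ≤⟨ m≤n+m (Pᵢ + Pⱼ) a ⟩
  a + (Pᵢ + Pⱼ)                 ∎
  where
  open ≤-Reasoning
  a≤t : a ≤ t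
  a≤t = ≮⇒≥ λ t<a → k≮2a (subst (_≤ 2 * a) (*-suc 2 t) (*-monoʳ-≤ 2 t<a))

m%2≡0⇒m≡2*[m/2] : ∀ m → m % 2 ≡ 0 → m ≡ 2 * (m / 2)
m%2≡0⇒m≡2*[m/2] m m%2≡0 = trans (m≡m%n+[m/n]*n m 2) (cong₂ _+_ m%2≡0 (*-comm (m / 2) 2))

m%2≡1⇒m≡1+2*[m/2] : ∀ m → m % 2 ≡ 1 → m ≡ suc (2 * (m / 2))
m%2≡1⇒m≡1+2*[m/2] m m%2≡1 = trans (m≡m%n+[m/n]*n m 2) (cong₂ _+_ m%2≡1 (*-comm (m / 2) 2))

2≤1+2t⇒1≤t : ∀ t → 2 ≤ suc (2 * t) → 1 ≤ t
2≤1+2t⇒1≤t zero    (s≤s ())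
2≤1+2t⇒1≤t (suc t) _ = s≤s z≤n

¬Fin⇒≡0 : ∀ {r} → ¬ Fin r → r ≡ 0
¬Fin⇒≡0 {zero}  _  = refl
¬Fin⇒≡0 {suc r} ¬i = contradiction zero ¬i

Fin-subsingleton⇒≤1 : ∀ {r} → ((i j : Fin r) → ¬ i ≢ j) → r ≤ 1
Fin-subsingleton⇒≤1 {zero}        _   = z≤n
Fin-subsingleton⇒≤1 {suc zero}    _   = s≤s z≤n
Fin-subsingleton⇒≤1 {suc (suc r)} sub = contradiction (λ ()) (sub zero (suc zero))

↑ˡ≢↑ʳ : ∀ {m n} (a : Fin m) (i : Fin n) → a ↑ˡ n ≢ m ↑ʳ i
↑ˡ≢↑ʳ {m} {n} a i e with trans (sym (splitAt-↑ˡ m a n)) (trans (cong (splitAt m) e) (splitAt-↑ʳ m n i))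
... | ()

≟-refl : ∀ {m} (a : Fin m) → ⌊ a ≟ a ⌋ ≡ true
≟-refl a = trans (isYes≗does (a ≟ a)) (dec-true (a ≟ a) refl)

≟-∨-≟ : ∀ {m} {a b c : Fin m} → (⌊ a ≟ b ⌋ ∨ ⌊ a ≟ c ⌋) ≡ true → a ≡ b ⊎ a ≡ c
≟-∨-≟ {a = a} {b} {c} e with a ≟ b | a ≟ c
≟-∨-≟ _  | yes a≡b | _       = inj₁ a≡b
≟-∨-≟ _  | no _    | yes a≡c = inj₂ a≡c
≟-∨-≟ () | no _    | no _

anyFin-true : ∀ {r} (p : Fin r → Bool) i → p i ≡ true → anyFin r p ≡ true
anyFin-true p zero    e rewrite e = refl
anyFin-true p (suc i) e rewrite anyFin-true (p ∘ suc) i e = ∨-zeroʳ (p zero)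

-- Graphs and Roman domination

leaf-nbr-unique : ∀ {n} (H : SimpleGraph n) {a b c} →
                  IsLeaf H a → adj H a b ≡ true → adj H a c ≡ true → b ≡ c
leaf-nbr-unique {n} H {a} {b} {c} leaf ab ac with b ≟ c
... | yes b≡c = b≡c
... | no b≢c  = contradiction (≤-trans 2≤degree (≤-reflexive leaf)) λ { (s≤s ()) }
  where
  2≤degree : 2 ≤ degree H a
  2≤degree = sumFin-masked-≥ n (adj H a) (const 1) ((b≢c ∷ []) ∷ [] ∷ []) (ab ∷ ac ∷ [])

closedNb-split : ∀ {m} (adj : Fin m → Fin m → Bool) {x y} →
                 (⌊ x ≟ y ⌋ ∨ adj x y) ≡ true → x ≡ y ⊎ adj x y ≡ true
closedNb-split adj {x} {y} e with x ≟ y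
... | yes x≡y = inj₁ x≡y
... | no _    = inj₂ e

closedNb-adj : ∀ {m} (adj : Fin m → Fin m → Bool) {x y} →
               adj x y ≡ true → (⌊ x ≟ y ⌋ ∨ adj x y) ≡ true
closedNb-adj adj {x} {y} e = trans (cong (⌊ x ≟ y ⌋ ∨_) e) (∨-zeroʳ _)

strongNb-split : ∀ {m} (adj : Fin m → Fin m → Bool) k (f : Fin m → ℕ) {x y} →
                 (adj x y ∧ ⌊ k <? 2 * f y ⌋) ≡ true → adj x y ≡ true × k < 2 * f y
strongNb-split adj k f {x} {y} e with adj x y | k <? 2 * f y
strongNb-split adj k f _  | true  | yes k<2fy = refl , k<2fy
strongNb-split adj k f () | true  | no _
strongNb-split adj k f () | false | _

strongNb-intro : ∀ {m} (adj : Fin m → Fin m → Bool) k (f : Fin m → ℕ) {x y} →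
                 adj x y ≡ true → k < 2 * f y → (adj x y ∧ ⌊ k <? 2 * f y ⌋) ≡ true
strongNb-intro adj k f {y = y} e k<2fy rewrite e = trans (isYes≗does (k <? 2 * f y)) (dec-true (k <? 2 * f y) k<2fy)

closedNbSum-mono : ∀ m adj {f g : Fin m → ℕ} x → (∀ y → (⌊ x ≟ y ⌋ ∨ adj x y) ≡ true → f y ≤ g y) →
                   closedNbSum m adj f x ≤ closedNbSum m adj g x
closedNbSum-mono m adj {f} {g} x f≤g = sumFin-mono m pointwise
  where
  pointwise : ∀ y → (if ⌊ x ≟ y ⌋ ∨ adj x y then f y else 0) ≤
                    (if ⌊ x ≟ y ⌋ ∨ adj x y then g y else 0)
  pointwise y with ⌊ x ≟ y ⌋ ∨ adj x y in eq
  ... | true  = f≤g y eq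
  ... | false = z≤n

strongNbSum-mono : ∀ m adj k {f g : Fin m → ℕ} x → (∀ y → adj x y ≡ true → f y ≤ g y) →
                   strongNbSum m adj k f x ≤ strongNbSum m adj k g x
strongNbSum-mono m adj k {f} {g} x f≤g = sumFin-mono m pointwise
  where
  pointwise : ∀ y → (if adj x y ∧ ⌊ k <? 2 * f y ⌋ then f y else 0) ≤
                    (if adj x y ∧ ⌊ k <? 2 * g y ⌋ then g y else 0)
  pointwise y with adj x y in eq | k <? 2 * f y | k <? 2 * g y
  ... | false | _        | _       = z≤n
  ... | true  | no _     | _       = z≤n
  ... | true  | yes _    | yes _   = f≤g y eq
  ... | true  | yes k<2f | no k≮2g = contradiction (<-≤-trans k<2f (*-monoʳ-≤ 2 (f≤g y eq))) k≮2g

IsRDF-upward : ∀ m adj k {f g : Fin m → ℕ} → (∀ x → f x ≤ g x) → (∀ x → g x ≤ k) →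
               IsRDF m adj k f → IsRDF m adj k g
IsRDF-upward m adj k f≤g g≤k (_ , f-dom) = g≤k , λ x 2gx<k →
  ≤-trans (f-dom x (≤-<-trans (*-monoʳ-≤ 2 (f≤g x)) 2gx<k)) (closedNbSum-mono m adj x (λ y _ → f≤g y))

IsSRDF-upward : ∀ m adj k {f g : Fin m → ℕ} → (∀ x → f x ≤ g x) → (∀ x → g x ≤ k) →
                IsSRDF m adj k f → IsSRDF m adj k g
IsSRDF-upward m adj k f≤g g≤k (_ , f-dom) = g≤k , λ x 2gx<k →
  ≤-trans (f-dom x (≤-<-trans (*-monoʳ-≤ 2 (f≤g x)) 2gx<k))
          (+-mono-≤ (f≤g x) (strongNbSum-mono m adj k x (λ y _ → f≤g y)))

const-RDF : ∀ m adj k → IsRDF m adj k (const k)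
const-RDF m adj k = (λ _ → ≤-refl) , λ _ 2k<k → contradiction 2k<k (≤⇒≯ (m≤n*m k 2))

const-SRDF : ∀ m adj k → IsSRDF m adj k (const k)
const-SRDF m adj k = (λ _ → ≤-refl) , λ _ 2k<k → contradiction 2k<k (≤⇒≯ (m≤n*m k 2))

-- The subdivided graph

module Subdivision {n} (H : SimpleGraph n) (u : Fin n) {r} (w : Fin r → Fin n) (pendant : PendantAt H u r w) where

  N : ℕ
  N = n + r

  A : Fin N → Fin N → Bool
  A = subdivAdj H u r w

  U : Fin N
  U = u ↑ˡ r

  V W : Fin r → Fin N
  V i = n ↑ʳ i
  W i = w i ↑ˡ r

  data Vertex : Fin N → Set where
    old : ∀ a → Vertex (a ↑ˡ r)
    new : ∀ i → Vertex (n ↑ʳ i)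

  vertex : ∀ x → Vertex x
  vertex x with splitAt n x in eq
  ... | inj₁ a = subst Vertex (splitAt⁻¹-↑ˡ eq) (old a)
  ... | inj₂ i = subst Vertex (splitAt⁻¹-↑ʳ eq) (new i)

  w-injective : ∀ {i j} → w i ≡ w j → i ≡ j
  w-injective = proj₁ pendant

  u-adj-w : ∀ i → adj H u (w i) ≡ true
  u-adj-w = proj₁ (proj₂ pendant)

  w-leaf : ∀ i → IsLeaf H (w i)
  w-leaf = proj₁ (proj₂ (proj₂ pendant))

  w≢u : ∀ i → w i ≢ u
  w≢u i w≡u = contradiction (trans (sym (subst (λ b → adj H u b ≡ true) w≡u (u-adj-w i))) (irrefl H u)) λ ()

  -- The local function of the same name in the definition of subdivAdj, needed to state its unfolding.
  inW : Fin n → Bool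
  inW b = anyFin r (λ i → ⌊ w i ≟ b ⌋)

  A-sym : ∀ x y → A x y ≡ A y x
  A-sym x y with vertex x | vertex y
  ... | old a | old b rewrite splitAt-↑ˡ n a r | splitAt-↑ˡ n b r =
    cong₂ _∧_ (SimpleGraph.sym H a b) (cong not (∨-comm (⌊ a ≟ u ⌋ ∧ inW b) (⌊ b ≟ u ⌋ ∧ inW a)))
  ... | old a | new j rewrite splitAt-↑ˡ n a r | splitAt-↑ʳ n r j = refl
  ... | new i | old b rewrite splitAt-↑ʳ n r i | splitAt-↑ˡ n b r = refl
  ... | new i | new j rewrite splitAt-↑ʳ n r i | splitAt-↑ʳ n r j = refl

  A-V-old : ∀ i a → A (V i) (a ↑ˡ r) ≡ (⌊ a ≟ u ⌋ ∨ ⌊ a ≟ w i ⌋)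
  A-V-old i a rewrite splitAt-↑ʳ n r i | splitAt-↑ˡ n a r = refl

  A-V-V : ∀ i j → A (V i) (V j) ≡ false
  A-V-V i j rewrite splitAt-↑ʳ n r i | splitAt-↑ʳ n r j = refl

  -- The only neighbour of the leaf wᵢ in H is u, and the edge u wᵢ has been subdivided.
  A-W-old : ∀ i a → A (W i) (a ↑ˡ r) ≡ false
  A-W-old i a rewrite splitAt-↑ˡ n (w i) r | splitAt-↑ˡ n a r with adj H (w i) a in e
  ... | false = refl
  ... | true rewrite leaf-nbr-unique H (w-leaf i) e (trans (SimpleGraph.sym H (w i) u) (u-adj-w i))
                   | ≟-refl u | anyFin-true (λ j → ⌊ w j ≟ w i ⌋) i (≟-refl (w i)) =
    cong not (∨-zeroʳ (⌊ w i ≟ u ⌋ ∧ inW u))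

  V-adj-U : ∀ i → A (V i) U ≡ true
  V-adj-U i rewrite A-V-old i u | ≟-refl u = refl

  V-adj-W : ∀ i → A (V i) (W i) ≡ true
  V-adj-W i rewrite A-V-old i (w i) | ≟-refl (w i) = ∨-zeroʳ _

  V-nbr : ∀ i {y} → A (V i) y ≡ true → y ≡ U ⊎ y ≡ W i
  V-nbr i {y} e with vertex y
  ... | old b = Sum.map (cong (_↑ˡ r)) (cong (_↑ˡ r)) (≟-∨-≟ (trans (sym (A-V-old i b)) e))
  ... | new j = contradiction (trans (sym (A-V-V i j)) e) λ ()

  W-nbr : ∀ i {y} → A (W i) y ≡ true → y ≡ V i
  W-nbr i {y} e with vertex y
  ... | old b = contradiction (trans (sym (A-W-old i b)) e) λ ()
  ... | new j with ≟-∨-≟ (trans (sym (A-V-old j (w i))) (trans (A-sym (V j) (W i)) e))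
  ...   | inj₁ wᵢ≡u  = contradiction wᵢ≡u (w≢u i)
  ...   | inj₂ wᵢ≡wⱼ = cong V (sym (w-injective wᵢ≡wⱼ))

  U≢V : ∀ i → U ≢ V i
  U≢V i = ↑ˡ≢↑ʳ u i

  U≢W : ∀ i → U ≢ W i
  U≢W i = w≢u i ∘ sym ∘ ↑ˡ-injective r u (w i)

  V≢W : ∀ i j → V i ≢ W j
  V≢W i j = ↑ˡ≢↑ʳ (w j) i ∘ sym

  V-injective : ∀ {i j} → V i ≡ V j → i ≡ j
  V-injective = ↑ʳ-injective n _ _

  W-injective : ∀ {i j} → W i ≡ W j → i ≡ j
  W-injective = w-injective ∘ ↑ˡ-injective r _ _

  data PathRole (i : Fin r) : Fin N → Set where
    isU  : PathRole i U
    isV  : PathRole i (V i)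
    isW  : PathRole i (W i)
    away : ∀ {x} → x ≢ U → x ≢ V i → x ≢ W i → PathRole i x

  pathRole : ∀ i x → PathRole i x
  pathRole i x with x ≟ U | x ≟ V i | x ≟ W i
  ... | yes refl | _        | _        = isU
  ... | no _     | yes refl | _        = isV
  ... | no _     | no _     | yes refl = isW
  ... | no x≢U   | no x≢V   | no x≢W   = away x≢U x≢V x≢W

  away-nbr : ∀ i {x y} → x ≢ U → x ≢ V i → x ≢ W i → A x y ≡ true → y ≢ V i × y ≢ W i
  away-nbr i x≢U x≢V x≢W e =
    (λ { refl → [ x≢U , x≢W ] (V-nbr i (trans (A-sym _ _) e)) }) ,
    (λ { refl → x≢V (W-nbr i (trans (A-sym _ _) e)) })

  closedNbSum-W-≤ : ∀ g i → closedNbSum N A g (W i) ≤ g (W i) + g (V i)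
  closedNbSum-W-≤ g i = ≤-trans (sumFin-masked-≤ N _ g nbrs) (≤-reflexive (cong (g (W i) +_) (+-identityʳ _)))
    where
    nbrs : ∀ y → (⌊ W i ≟ y ⌋ ∨ A (W i) y) ≡ true → y ∈ W i ∷ V i ∷ []
    nbrs y e with closedNb-split A e
    ... | inj₁ refl = here refl
    ... | inj₂ a    = there (here (W-nbr i a))

  closedNbSum-V-≤ : ∀ g i → closedNbSum N A g (V i) ≤ g (V i) + (g U + g (W i))
  closedNbSum-V-≤ g i =
    ≤-trans (sumFin-masked-≤ N _ g nbrs) (≤-reflexive (cong (λ z → g (V i) + (g U + z)) (+-identityʳ _)))
    where
    nbrs : ∀ y → (⌊ V i ≟ y ⌋ ∨ A (V i) y) ≡ true → y ∈ V i ∷ U ∷ W i ∷ []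
    nbrs y e with closedNb-split A e
    ... | inj₁ refl = here refl
    ... | inj₂ a    = there ([ here , there ∘ here ]′ (V-nbr i a))

  closedNbSum-V-≥ : ∀ g i → g U + g (W i) ≤ closedNbSum N A g (V i)
  closedNbSum-V-≥ g i =
    ≤-trans (≤-reflexive (cong (g U +_) (sym (+-identityʳ _))))
            (sumFin-masked-≥ N _ g ((U≢W i ∷ []) ∷ [] ∷ [])
              (closedNb-adj A (V-adj-U i) ∷ closedNb-adj A (V-adj-W i) ∷ []))

  strongNbSum-W-≤ : ∀ k g i → strongNbSum N A k g (W i) ≤ g (V i)
  strongNbSum-W-≤ k g i = ≤-trans (sumFin-masked-≤ N _ g nbrs) (≤-reflexive (+-identityʳ _))
    where
    nbrs : ∀ y → (A (W i) y ∧ ⌊ k <? 2 * g y ⌋) ≡ true → y ∈ V i ∷ []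
    nbrs y e = here (W-nbr i (proj₁ (strongNb-split A k g e)))

  strongNbSum-V-≤ : ∀ k g i → ¬ k < 2 * g U → strongNbSum N A k g (V i) ≤ g (W i)
  strongNbSum-V-≤ k g i k≮2gU = ≤-trans (sumFin-masked-≤ N _ g nbrs) (≤-reflexive (+-identityʳ _))
    where
    nbrs : ∀ y → (A (V i) y ∧ ⌊ k <? 2 * g y ⌋) ≡ true → y ∈ W i ∷ []
    nbrs y e with strongNb-split A k g e
    ... | a , k<2gy with V-nbr i a
    ...   | inj₁ refl = contradiction k<2gy k≮2gU
    ...   | inj₂ y≡W  = here y≡W

  strongNbSum-V-≥ : ∀ k g i → k < 2 * g U → k < 2 * g (W i) → g U + g (W i) ≤ strongNbSum N A k g (V i)
  strongNbSum-V-≥ k g i k<2gU k<2gW =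
    ≤-trans (≤-reflexive (cong (g U +_) (sym (+-identityʳ _))))
            (sumFin-masked-≥ N _ g ((U≢W i ∷ []) ∷ [] ∷ [])
              (strongNb-intro A k g (V-adj-U i) k<2gU ∷ strongNb-intro A k g (V-adj-W i) k<2gW ∷ []))

  pathWeight : (Fin N → ℕ) → Fin r → ℕ
  pathWeight g i = g (V i) + g (W i)

  RDF-pathWeight : ∀ {k} g i → IsRDF N A k g → k ≤ 2 * pathWeight g i
  RDF-pathWeight {k} g i (_ , g-dom) =
    pendantPath-≥ k (g (V i)) (g (W i)) (λ 2gW<k → ≤-trans (g-dom (W i) 2gW<k) (closedNbSum-W-≤ g i))

  RDF-pathWeight-with-U : ∀ {k} g i → IsRDF N A k g → k ≤ g U + pathWeight g i
  RDF-pathWeight-with-U {k} g i (_ , g-dom) = pendantPath-centre-≥ k (g (V i)) (g (W i)) (g U)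
    (λ 2gW<k → ≤-trans (g-dom (W i) 2gW<k) (closedNbSum-W-≤ g i))
    (λ 2gV<k → ≤-trans (g-dom (V i) 2gV<k) (closedNbSum-V-≤ g i))

  SRDF-pathWeight : ∀ {k} g i → IsSRDF N A k g → k ≤ 2 * pathWeight g i
  SRDF-pathWeight {k} g i (_ , g-dom) = pendantPath-≥ k (g (V i)) (g (W i))
    (λ 2gW<k → ≤-trans (g-dom (W i) 2gW<k) (+-monoʳ-≤ (g (W i)) (strongNbSum-W-≤ k g i)))

  -- A light u does not count in the strong neighbourhood sum of vᵢ, hence c = 0.
  SRDF-pathWeight-light-U : ∀ {k} g i → IsSRDF N A k g → ¬ k < 2 * g U → k ≤ pathWeight g i
  SRDF-pathWeight-light-U {k} g i (_ , g-dom) k≮2gU = pendantPath-centre-≥ k (g (V i)) (g (W i)) 0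
    (λ 2gW<k → ≤-trans (g-dom (W i) 2gW<k) (+-monoʳ-≤ (g (W i)) (strongNbSum-W-≤ k g i)))
    (λ 2gV<k → ≤-trans (g-dom (V i) 2gV<k) (+-monoʳ-≤ (g (V i)) (strongNbSum-V-≤ k g i k≮2gU)))

  raiseU : ℕ → (Fin N → ℕ) → Fin N → ℕ
  raiseU h g = updateAt g U (_⊔ h)

  loadLeaf : Fin r → ℕ → (Fin N → ℕ) → Fin N → ℕ
  loadLeaf i h g = updateAt (updateAt g (V i) (const 0)) (W i) (const h)

  raiseU-U : ∀ h g → raiseU h g U ≡ g U ⊔ h
  raiseU-U h g = updateAt-updates U g

  raiseU-other : ∀ h g {y} → y ≢ U → raiseU h g y ≡ g y
  raiseU-other h g {y} = updateAt-minimal y U g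

  raiseU-≥ : ∀ h g y → g y ≤ raiseU h g y
  raiseU-≥ h g y with y ≟ U
  ... | yes refl = subst (g U ≤_) (sym (raiseU-U h g)) (m≤m⊔n (g U) h)
  ... | no y≢U   = ≤-reflexive (sym (raiseU-other h g y≢U))

  raiseU-≤ : ∀ {k} h g → h ≤ k → (∀ y → g y ≤ k) → ∀ y → raiseU h g y ≤ k
  raiseU-≤ h g h≤k g≤k y with y ≟ U
  ... | yes refl = subst (_≤ _) (sym (raiseU-U h g)) (⊔-lub (g≤k U) h≤k)
  ... | no y≢U   = subst (_≤ _) (sym (raiseU-other h g y≢U)) (g≤k y)

  raiseU-weight : ∀ h g → weight N (raiseU h g) + g U ≡ weight N g + (g U ⊔ h)
  raiseU-weight h g = sumFin-updateAt N g U (_⊔ h)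

  pathWeight-raiseU : ∀ h g i → pathWeight (raiseU h g) i ≡ pathWeight g i
  pathWeight-raiseU h g i = cong₂ _+_ (raiseU-other h g (U≢V i ∘ sym)) (raiseU-other h g (U≢W i ∘ sym))

  loadLeaf-V : ∀ i h g → loadLeaf i h g (V i) ≡ 0
  loadLeaf-V i h g = trans (updateAt-minimal (V i) (W i) _ (V≢W i i)) (updateAt-updates (V i) g)

  loadLeaf-W : ∀ i h g → loadLeaf i h g (W i) ≡ h
  loadLeaf-W i h g = updateAt-updates (W i) _

  loadLeaf-other : ∀ i h g {y} → y ≢ V i → y ≢ W i → loadLeaf i h g y ≡ g y
  loadLeaf-other i h g {y} y≢V y≢W = trans (updateAt-minimal y (W i) _ y≢W) (updateAt-minimal y (V i) g y≢V)

  loadLeaf-U : ∀ i h g → loadLeaf i h g U ≡ g U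
  loadLeaf-U i h g = loadLeaf-other i h g (U≢V i) (U≢W i)

  loadLeaf-≤ : ∀ {k} i h g → h ≤ k → (∀ y → g y ≤ k) → ∀ y → loadLeaf i h g y ≤ k
  loadLeaf-≤ i h g h≤k g≤k y with pathRole i y
  ... | isU            = subst (_≤ _) (sym (loadLeaf-U i h g)) (g≤k U)
  ... | isV            = subst (_≤ _) (sym (loadLeaf-V i h g)) z≤n
  ... | isW            = subst (_≤ _) (sym (loadLeaf-W i h g)) h≤k
  ... | away _ y≢V y≢W = subst (_≤ _) (sym (loadLeaf-other i h g y≢V y≢W)) (g≤k y)

  loadLeaf-weight : ∀ i h g → weight N (loadLeaf i h g) + pathWeight g i ≡ weight N g + h
  loadLeaf-weight i h g = trans (cong (λ z → weight N (loadLeaf i h g) + (g (V i) + z)) (sym g₀-W))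
    (balance-trans (weight N (loadLeaf i h g)) (weight N g₀) (weight N g)
                   (sumFin-updateAt N g₀ (W i) (const h)) (sumFin-updateAt N g (V i) (const 0)))
    where
    g₀ : Fin N → ℕ
    g₀ = updateAt g (V i) (const 0)
    g₀-W : g₀ (W i) ≡ g (W i)
    g₀-W = updateAt-minimal (W i) (V i) g (V≢W i i ∘ sym)

  pathWeight-loadLeaf : ∀ {i j} h g → i ≢ j → pathWeight (loadLeaf j h g) i ≡ pathWeight g i
  pathWeight-loadLeaf {i} {j} h g i≢j = cong₂ _+_
    (loadLeaf-other j h g (i≢j ∘ V-injective) (V≢W i j))
    (loadLeaf-other j h g (V≢W j i ∘ sym) (i≢j ∘ W-injective))

  loadLeaf-RDF : ∀ {k} i h g → k ≤ 2 * h → h ≤ k → h ≤ g U → IsRDF N A k g → IsRDF N A k (loadLeaf i h g)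
  loadLeaf-RDF {k} i h g k≤2h h≤k h≤gU (g≤k , g-dom) = loadLeaf-≤ i h g h≤k g≤k , f-dom
    where
    f : Fin N → ℕ
    f = loadLeaf i h g
    k≤2fU : k ≤ 2 * f U
    k≤2fU = ≤-trans k≤2h (*-monoʳ-≤ 2 (subst (h ≤_) (sym (loadLeaf-U i h g)) h≤gU))
    k≤2fW : k ≤ 2 * f (W i)
    k≤2fW = subst (λ z → k ≤ 2 * z) (sym (loadLeaf-W i h g)) k≤2h
    f-dom : ∀ x → 2 * f x < k → k ≤ closedNbSum N A f x
    f-dom x 2fx<k with pathRole i x
    ... | isU = contradiction 2fx<k (≤⇒≯ k≤2fU)
    ... | isW = contradiction 2fx<k (≤⇒≯ k≤2fW)
    ... | isV = begin
      k                       ≤⟨ k≤2h ⟩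
      2 * h                   ≡⟨ cong (h +_) (+-identityʳ h) ⟩
      h + h                   ≤⟨ +-monoˡ-≤ h h≤gU ⟩
      g U + h                 ≡⟨ cong₂ _+_ (loadLeaf-U i h g) (loadLeaf-W i h g) ⟨
      f U + f (W i)           ≤⟨ closedNbSum-V-≥ f i ⟩
      closedNbSum N A f (V i) ∎
      where open ≤-Reasoning
    ... | away x≢U x≢V x≢W =
      ≤-trans (g-dom x (subst (λ z → 2 * z < k) (loadLeaf-other i h g x≢V x≢W) 2fx<k))
              (closedNbSum-mono N A x unchanged)
      where
      unchanged : ∀ y → (⌊ x ≟ y ⌋ ∨ A x y) ≡ true → g y ≤ f y
      unchanged y e with closedNb-split A e
      ... | inj₁ refl = ≤-reflexive (sym (loadLeaf-other i h g x≢V x≢W))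
      ... | inj₂ a    = ≤-reflexive (sym (uncurry (loadLeaf-other i h g) (away-nbr i x≢U x≢V x≢W a)))

  loadLeaf-SRDF : ∀ {k} i h g → k < 2 * h → h ≤ k → h ≤ g U → IsSRDF N A k g → IsSRDF N A k (loadLeaf i h g)
  loadLeaf-SRDF {k} i h g k<2h h≤k h≤gU (g≤k , g-dom) = loadLeaf-≤ i h g h≤k g≤k , f-dom
    where
    f : Fin N → ℕ
    f = loadLeaf i h g
    k<2fU : k < 2 * f U
    k<2fU = <-≤-trans k<2h (*-monoʳ-≤ 2 (subst (h ≤_) (sym (loadLeaf-U i h g)) h≤gU))
    k<2fW : k < 2 * f (W i)
    k<2fW = subst (λ z → k < 2 * z) (sym (loadLeaf-W i h g)) k<2h
    f-dom : ∀ x → 2 * f x < k → k ≤ f x + strongNbSum N A k f x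
    f-dom x 2fx<k with pathRole i x
    ... | isU = contradiction 2fx<k (<⇒≯ k<2fU)
    ... | isW = contradiction 2fx<k (<⇒≯ k<2fW)
    ... | isV = begin
      k                                   ≤⟨ <⇒≤ k<2h ⟩
      2 * h                               ≡⟨ cong (h +_) (+-identityʳ h) ⟩
      h + h                               ≤⟨ +-monoˡ-≤ h h≤gU ⟩
      g U + h                             ≡⟨ cong₂ _+_ (loadLeaf-U i h g) (loadLeaf-W i h g) ⟨
      f U + f (W i)                       ≤⟨ strongNbSum-V-≥ k f i k<2fU k<2fW ⟩
      strongNbSum N A k f (V i)           ≡⟨ cong (_+ strongNbSum N A k f (V i)) (loadLeaf-V i h g) ⟨
      f (V i) + strongNbSum N A k f (V i) ∎
      where open ≤-Reasoning
    ... | away x≢U x≢V x≢W =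
      ≤-trans (g-dom x (subst (λ z → 2 * z < k) f≡g 2fx<k))
              (+-mono-≤ (≤-reflexive (sym f≡g)) (strongNbSum-mono N A k x unchanged))
      where
      f≡g : f x ≡ g x
      f≡g = loadLeaf-other i h g x≢V x≢W
      unchanged : ∀ y → A x y ≡ true → g y ≤ f y
      unchanged y a = ≤-reflexive (sym (uncurry (loadLeaf-other i h g) (away-nbr i x≢U x≢V x≢W a)))

  RDF-improve : ∀ t i g → IsRDF N A (2 * t) g →
                ∃ λ f → IsRDF N A (2 * t) f × weight N f ≤ weight N g × 2 * t ≤ 2 * f U
  RDF-improve t i g g-RDF = f , f-RDF , f≤g , *-monoʳ-≤ 2 (subst (t ≤_) (sym (loadLeaf-U i t g₀)) t≤g₀U)
    where
    g₀ f : Fin N → ℕ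
    g₀ = raiseU t g
    f  = loadLeaf i t g₀
    t≤2t : t ≤ 2 * t
    t≤2t = m≤n*m t 2
    t≤g₀U : t ≤ g₀ U
    t≤g₀U = subst (t ≤_) (sym (raiseU-U t g)) (m≤n⊔m (g U) t)
    f-RDF : IsRDF N A (2 * t) f
    f-RDF = loadLeaf-RDF i t g₀ ≤-refl t≤2t t≤g₀U
              (IsRDF-upward N A (2 * t) (raiseU-≥ t g) (raiseU-≤ t g t≤2t (proj₁ g-RDF)) g-RDF)
    load : weight N f + pathWeight g i ≡ weight N g₀ + t
    load = trans (cong (weight N f +_) (sym (pathWeight-raiseU t g i))) (loadLeaf-weight i t g₀)
    f≤g : weight N f ≤ weight N g
    f≤g = balance⇒≤ (balance-trans (weight N f) (weight N g₀) (weight N g) load (raiseU-weight t g))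
            (even-budget t (g U) (pathWeight g i) (RDF-pathWeight g i g-RDF) (RDF-pathWeight-with-U g i g-RDF))

  SRDF-improve : ∀ t → 1 ≤ t → ∀ {i j} → i ≢ j → ∀ g → IsSRDF N A (suc (2 * t)) g →
                 ∃ λ f → IsSRDF N A (suc (2 * t)) f × weight N f ≤ weight N g × suc (2 * t) ≤ 2 * f U
  SRDF-improve t 1≤t {i} {j} i≢j g g-SRDF = f , f-SRDF , f≤g , <⇒≤ (<-≤-trans k<2s (*-monoʳ-≤ 2 s≤fU))
    where
    k s : ℕ
    k = suc (2 * t)
    s = suc t
    g₀ g₁ f : Fin N → ℕ
    g₀ = raiseU s g
    g₁ = loadLeaf i s g₀
    f  = loadLeaf j s g₁
    k<2s : k < 2 * s
    k<2s = ≤-reflexive (sym (*-suc 2 t))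
    s≤k : s ≤ k
    s≤k = s≤s (m≤n*m t 2)
    s≤g₀U : s ≤ g₀ U
    s≤g₀U = subst (s ≤_) (sym (raiseU-U s g)) (m≤n⊔m (g U) s)
    s≤g₁U : s ≤ g₁ U
    s≤g₁U = subst (s ≤_) (sym (loadLeaf-U i s g₀)) s≤g₀U
    s≤fU : s ≤ f U
    s≤fU = subst (s ≤_) (sym (loadLeaf-U j s g₁)) s≤g₁U
    f-SRDF : IsSRDF N A k f
    f-SRDF = loadLeaf-SRDF j s g₁ k<2s s≤k s≤g₁U (loadLeaf-SRDF i s g₀ k<2s s≤k s≤g₀U
               (IsSRDF-upward N A k (raiseU-≥ s g) (raiseU-≤ s g s≤k (proj₁ g-SRDF)) g-SRDF))
    load-i : weight N g₁ + pathWeight g i ≡ weight N g₀ + s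
    load-i = trans (cong (weight N g₁ +_) (sym (pathWeight-raiseU s g i))) (loadLeaf-weight i s g₀)
    load-j : weight N f + pathWeight g j ≡ weight N g₁ + s
    load-j = trans (cong (weight N f +_) (sym Pⱼ-unchanged)) (loadLeaf-weight j s g₁)
      where
      Pⱼ-unchanged : pathWeight g₁ j ≡ pathWeight g j
      Pⱼ-unchanged = trans (pathWeight-loadLeaf s g₀ (i≢j ∘ sym)) (pathWeight-raiseU s g j)
    f≤g : weight N f ≤ weight N g
    f≤g = balance⇒≤
      (balance-trans (weight N f) (weight N g₀) (weight N g)
         (balance-trans (weight N f) (weight N g₁) (weight N g₀) load-j load-i) (raiseU-weight s g))
      (odd-budget t (g U) (pathWeight g i) (pathWeight g j) 1≤t
         (SRDF-pathWeight g i g-SRDF) (SRDF-pathWeight g j g-SRDF)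
         (λ k≮2gU → SRDF-pathWeight-light-U g i g-SRDF k≮2gU , SRDF-pathWeight-light-U g j g-SRDF k≮2gU))

  light-γRDF⇒no-pendant : ∀ {k} t → k ≡ 2 * t → (∀ f → IsGammaRDF N A k f → 2 * f U < k) → ¬ Fin r
  light-γRDF⇒no-pendant t refl light i =
    ¬¬-minimal-satisfying (weight N) (const (2 * t) , const-RDF N A (2 * t)) (RDF-improve t i)
      λ (f , γ , heavy) → <⇒≱ (light f γ) heavy

  light-γSRDF⇒≤1-pendant : ∀ {k} t → k ≡ suc (2 * t) → 1 ≤ t →
                           (∀ f → IsGammaSRDF N A k f → 2 * f U < k) → (i j : Fin r) → ¬ i ≢ j
  light-γSRDF⇒≤1-pendant t refl 1≤t light i j i≢j =
    ¬¬-minimal-satisfying (weight N) (const (suc (2 * t)) , const-SRDF N A (suc (2 * t))) (SRDF-improve t 1≤t i≢j)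
      λ (f , γ , heavy) → <⇒≱ (light f γ) heavy

lemma2p5 : (k : ℕ) → 2 ≤ k → (n : ℕ) → (H : SimpleGraph n) → Connected H
    → (u : Fin n) → (r : ℕ) → (w : Fin r → Fin n) → PendantAt H u r w
    → (k % 2 ≡ 0
        → (∀ f → IsGammaRDF (n + r) (subdivAdj H u r w) k f → 2 * f (u ↑ˡ r) < k)
        → r ≡ 0)
      × (k % 2 ≡ 1
        → (∀ f → IsGammaSRDF (n + r) (subdivAdj H u r w) k f → 2 * f (u ↑ˡ r) < k)
        → r ≤ 1)
lemma2p5 k 2≤k n H _ u r w pendant =
  (λ k-even light → ¬Fin⇒≡0 (light-γRDF⇒no-pendant t (m%2≡0⇒m≡2*[m/2] k k-even) light)) ,
  (λ k-odd light →
    let k≡1+2t : k ≡ suc (2 * t)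
        k≡1+2t = m%2≡1⇒m≡1+2*[m/2] k k-odd
    in  Fin-subsingleton⇒≤1
          (light-γSRDF⇒≤1-pendant t k≡1+2t (2≤1+2t⇒1≤t t (subst (2 ≤_) k≡1+2t 2≤k)) light))
  where
  open Subdivision H u w pendant
  t : ℕ
  t = k / 2
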